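{- If $\Gamma\vdash_s M:A\to B$ and $\Gamma\vdash_s N:A$ are derivable in $\Lambda_\cap^s$, then $\Gamma\vdash_s MN:B$ is derivable in $\Lambda_\cap^s$.
   Context: $\lambda$-terms: $M::=x\mid MM\mid\lambda x.M$ modulo $\alpha$-conversion; $M[x:=N]$ capture-avoiding substitution. Types: $A::=\varphi\mid A\to A\mid A\cap A$. A typing context is a finite set of pairs $x:A$, where a variable may occur with several types; $\Gamma,x:A$ denotes $\Gamma\cup\{x:A\}$; $x\notin\Gamma$ means no $x:C$ lies in $\Gamma$. Rules of $\Lambda_\cap^s$ ($n\ge0$): (Ax) $\Gamma,x:A\vdash_s x:A$; $(\mathsf{Beta})^s$ from $\Gamma\vdash_s M[x:=N]N_1\dots N_n:A$ and $\Gamma\vdash_s N:B$ infer $\Gamma\vdash_s(\lambda x.M)NN_1\dots N_n:A$; $(\mathsf{L}\to)$ from $\Gamma\vdash_s N:A_1$ and $\Gamma,y:A_2\vdash_s yN_1\dots N_n:B$, with $y\notin FV(N_1)\cup\dots\cup FV(N_n)$, $y\notin\Gamma$, infer $\Gamma,x:A_1\to A_2\vdash_s xNN_1\dots N_n:B$; $(\mathsf{R}\to)$ from $\Gamma,x:A\vdash_s M:B$, $x\notin\Gamma$, infer $\Gamma\vdash_s\lambda x.M:A\to B$; $(\mathsf{L}\cap)$ from $\Gamma,x:A_1,x:A_2\vdash_s xN_1\dots N_n:B$ infer $\Gamma,x:A_1\cap A_2\vdash_s xN_1\dots N_n:B$; $(\mathsf{R}\cap)$ from $\Gamma\vdash_s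 M:A$ and $\Gamma\vdash_s M:B$ infer $\Gamma\vdash_s M:A\cap B$. -}

module Defs where

open import Data.Nat using (ℕ; zero; suc)
open import Data.List using (List; []; _∷_; map)
open import Data.Product using (_×_; _,_)
open import Data.Empty using (⊥)
open import Data.Unit using (⊤)
open import Data.Sum using (_⊎_)
open import Relation.Nullary using (¬_)
open import Relation.Binary.PropositionalEquality using (_≡_)
open import Data.List.Membership.Propositional using (_∈_)
open import Function.Bundles using (_⇔_)

infixr 7 _⇒_
infixl 8 _∩_
data Ty : Set where
  atom : ℕ → Ty
  _⇒_  : Ty → Ty → Ty
  _∩_  : Ty → Ty → Ty

-- λ-terms modulo α-conversion, represented with de Bruijn indices
-- (free variables are the indices escaping all binders).
infixl 9 _·_
data Term : Set where
  var : ℕ → Term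
  _·_ : Term → Term → Term
  ƛ_  : Term → Term

apps : Term → List Term → Term
apps M []       = M
apps M (N ∷ Ns) = apps (M · N) Ns

_∈FV_ : ℕ → Term → Set
x ∈FV var y  = x ≡ y
x ∈FV (M · N) = x ∈FV M ⊎ x ∈FV N
x ∈FV (ƛ M)  = suc x ∈FV M

_∉FVs_ : ℕ → List Term → Set
x ∉FVs []       = ⊤
x ∉FVs (N ∷ Ns) = ¬ (x ∈FV N) × x ∉FVs Ns

ext : (ℕ → ℕ) → ℕ → ℕ
ext ρ zero    = zero
ext ρ (suc x) = suc (ρ x)

rename : (ℕ → ℕ) → Term → Term
rename ρ (var x) = var (ρ x)
rename ρ (M · N) = rename ρ M · rename ρ N
rename ρ (ƛ M)   = ƛ rename (ext ρ) M

exts : (ℕ → Term) → ℕ → Term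
exts σ zero    = var zero
exts σ (suc x) = rename suc (σ x)

subst : (ℕ → Term) → Term → Term
subst σ (var x) = σ x
subst σ (M · N) = subst σ M · subst σ N
subst σ (ƛ M)   = ƛ subst (exts σ) M

σ₀ : Term → ℕ → Term
σ₀ N zero    = N
σ₀ N (suc x) = var x

-- M[x:=N] for the bound variable x of  λx.M  (index 0 of the body M)
_[_] : Term → Term → Term
M [ N ] = subst (σ₀ N) M

-- Typing contexts: finite sets of pairs x:A, represented by lists
-- considered up to set equality (same members).
Ctx : Set
Ctx = List (ℕ × Ty)

_≋_ : Ctx → Ctx → Set
Γ ≋ Δ = ∀ p → (p ∈ Γ) ⇔ (p ∈ Δ)

_∉Ctx_ : ℕ → Ctx → Set
x ∉Ctx Γ = ∀ C → ¬ ((x , C) ∈ Γ)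

shiftCtx : Ctx → Ctx
shiftCtx = map (λ { (x , C) → (suc x , C) })

-- The system Λ∩ˢ.  A conclusion context "Γ, x:A" = Γ ∪ {x:A} is any
-- context Δ set-equal to (x , A) ∷ Γ.
infix 4 _⊢ˢ_∶_
data _⊢ˢ_∶_ : Ctx → Term → Ty → Set where
  Ax   : ∀ {Δ Γ x A} → Δ ≋ ((x , A) ∷ Γ) → Δ ⊢ˢ var x ∶ A
  Beta : ∀ {Γ M N Ns A B} →
         Γ ⊢ˢ apps (M [ N ]) Ns ∶ A → Γ ⊢ˢ N ∶ B →
         Γ ⊢ˢ apps ((ƛ M) · N) Ns ∶ A
  L⇒   : ∀ {Δ Γ x y N Ns A₁ A₂ B} →
         Δ ≋ ((x , A₁ ⇒ A₂) ∷ Γ) →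
         y ∉FVs Ns → y ∉Ctx Γ →
         Γ ⊢ˢ N ∶ A₁ → ((y , A₂) ∷ Γ) ⊢ˢ apps (var y) Ns ∶ B →
         Δ ⊢ˢ apps (var x · N) Ns ∶ B
  R⇒   : ∀ {Γ M A B} →
         ((zero , A) ∷ shiftCtx Γ) ⊢ˢ M ∶ B →
         Γ ⊢ˢ ƛ M ∶ A ⇒ B
  L∩   : ∀ {Δ Γ x Ns A₁ A₂ B} →
         Δ ≋ ((x , A₁ ∩ A₂) ∷ Γ) →
         ((x , A₁) ∷ (x , A₂) ∷ Γ) ⊢ˢ apps (var x) Ns ∶ B →
         Δ ⊢ˢ apps (var x) Ns ∶ B
  R∩   : ∀ {Γ M A B} → Γ ⊢ˢ M ∶ A → Γ ⊢ˢ M ∶ B → Γ ⊢ˢ M ∶ A ∩ B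

-- Λ∩ˢ has no cut rule, and typing M N from M : A → B and N : A is a cut on
-- A → B. It is proved admissible together with substitution, by
-- induction on the size of the cut type. Applying a derivation of
-- λx.M : A → B to N gives a Beta redex whose body M[x:=N] needs substitution
-- of a term of type A; substituting a term P of type A₁ → A₂ for the head
-- variable of an (L→) step needs the application P N with N : A₁, where A₁
-- is smaller. Within one size both lemmas go by induction on derivations.
-- The eigenvariable of (L→) must be renamed apart from the new arguments,
-- so the application lemma is stated up to a renaming of the context.
module Submission where

open import Defs
open import Data.Nat using (ℕ; zero; suc; _+_; _≤_; _<_; _⊔_; s≤s; _≟_)
open import Data.Nat.Properties
  using (≤-refl; ≤-trans; <⇒≱; ≤-<-trans; m≤m⊔n; m≤n⊔m; m≤m+n; m≤n+m; n≤1+n; m≤n⇒m≤1+n)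
open import Data.List using (List; []; _∷_; map; _++_) renaming ([_] to [_]ₗ)
open import Data.List.Membership.Propositional using (_∈_)
open import Data.List.Membership.Propositional.Properties using (∈-map⁺; ∈-map⁻)
open import Data.List.Relation.Binary.Subset.Propositional using (_⊆_)
open import Data.List.Relation.Unary.Any using (here; there)
open import Data.Product using (∃; _×_; _,_)
open import Data.Sum using (inj₁; inj₂)
open import Data.Unit using (⊤; tt)
open import Function using (_∘_; id)
open import Function.Bundles using (mk⇔; Equivalence)
open import Relation.Nullary using (yes; no; contradiction)
open import Relation.Binary.PropositionalEquality using (_≡_; _≢_; refl; sym; trans; cong; cong₂; module ≡-Reasoning)
  renaming (subst to ≡-subst)

≋∷⇒∈ : ∀ {Δ x A Γ} → Δ ≋ ((x , A) ∷ Γ) → (x , A) ∈ Δ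
≋∷⇒∈ e = Equivalence.from (e _) (here refl)

≋∷⇒⊆ : ∀ {Δ x A Γ} → Δ ≋ ((x , A) ∷ Γ) → Γ ⊆ Δ
≋∷⇒⊆ e m = Equivalence.from (e _) (there m)

∈⇒≋∷ : ∀ {Δ x A} → (x , A) ∈ Δ → Δ ≋ ((x , A) ∷ Δ)
∈⇒≋∷ m _ = mk⇔ there (λ { (here refl) → m ; (there q) → q })

∉Ctx⇒≢ : ∀ {Γ y z T} → y ∉Ctx Γ → (z , T) ∈ Γ → z ≢ y
∉Ctx⇒≢ y∉Γ m refl = y∉Γ _ m

∈-shiftCtx⁺ : ∀ {Γ x T} → (x , T) ∈ Γ → (suc x , T) ∈ shiftCtx Γ
∈-shiftCtx⁺ = ∈-map⁺ _

∈-shiftCtx⁻ : ∀ {Γ z T} → (z , T) ∈ shiftCtx Γ → ∃ λ x → z ≡ suc x × (x , T) ∈ Γ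
∈-shiftCtx⁻ m with ∈-map⁻ _ m
... | (x , _) , m′ , refl = x , refl , m′

fvBound : Term → ℕ
fvBound (var x) = x
fvBound (M · N) = fvBound M ⊔ fvBound N
fvBound (ƛ M)   = fvBound M

fvBounds : List Term → ℕ
fvBounds []       = 0
fvBounds (N ∷ Ns) = fvBound N ⊔ fvBounds Ns

ctxBound : Ctx → ℕ
ctxBound []            = 0
ctxBound ((x , _) ∷ Γ) = x ⊔ ctxBound Γ

∈FV⇒≤fvBound : ∀ {x} M → x ∈FV M → x ≤ fvBound M
∈FV⇒≤fvBound (var y) refl     = ≤-refl
∈FV⇒≤fvBound (M · N) (inj₁ p) = ≤-trans (∈FV⇒≤fvBound M p) (m≤m⊔n _ _)
∈FV⇒≤fvBound (M · N) (inj₂ p) = ≤-trans (∈FV⇒≤fvBound N p) (m≤n⊔m _ _)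
∈FV⇒≤fvBound (ƛ M)   p        = ≤-trans (n≤1+n _) (∈FV⇒≤fvBound M p)

∈⇒≤ctxBound : ∀ {Γ x C} → (x , C) ∈ Γ → x ≤ ctxBound Γ
∈⇒≤ctxBound (here refl) = m≤m⊔n _ _
∈⇒≤ctxBound (there m)   = ≤-trans (∈⇒≤ctxBound m) (m≤n⊔m _ _)

>fvBounds⇒∉FVs : ∀ {y} Ns → fvBounds Ns < y → y ∉FVs Ns
>fvBounds⇒∉FVs []       _ = tt
>fvBounds⇒∉FVs (N ∷ Ns) lt =
  (λ p → <⇒≱ lt (≤-trans (∈FV⇒≤fvBound N p) (m≤m⊔n _ _))) ,
  >fvBounds⇒∉FVs Ns (≤-<-trans (m≤n⊔m _ _) lt)

fresh : Ctx → List Term → ℕ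
fresh Γ Ns = suc (ctxBound Γ ⊔ fvBounds Ns)

fresh-∉Ctx : ∀ Γ Ns → fresh Γ Ns ∉Ctx Γ
fresh-∉Ctx Γ Ns _ m = <⇒≱ (s≤s (m≤m⊔n _ _)) (∈⇒≤ctxBound m)

fresh-∉FVs : ∀ Γ Ns → fresh Γ Ns ∉FVs Ns
fresh-∉FVs Γ Ns = >fvBounds⇒∉FVs Ns (s≤s (m≤n⊔m _ _))

rename-cong : ∀ {ρ ρ′} M → (∀ x → x ∈FV M → ρ x ≡ ρ′ x) → rename ρ M ≡ rename ρ′ M
rename-cong (var x) h = cong var (h x refl)
rename-cong (M · N) h = cong₂ _·_ (rename-cong M (λ x → h x ∘ inj₁)) (rename-cong N (λ x → h x ∘ inj₂))
rename-cong {ρ} {ρ′} (ƛ M) h = cong ƛ_ (rename-cong M h′)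
  where h′ : ∀ x → x ∈FV M → ext ρ x ≡ ext ρ′ x
        h′ zero    _ = refl
        h′ (suc x) p = cong suc (h x p)

subst-cong : ∀ {σ σ′} M → (∀ x → x ∈FV M → σ x ≡ σ′ x) → subst σ M ≡ subst σ′ M
subst-cong (var x) h = h x refl
subst-cong (M · N) h = cong₂ _·_ (subst-cong M (λ x → h x ∘ inj₁)) (subst-cong N (λ x → h x ∘ inj₂))
subst-cong {σ} {σ′} (ƛ M) h = cong ƛ_ (subst-cong M h′)
  where h′ : ∀ x → x ∈FV M → exts σ x ≡ exts σ′ x
        h′ zero    _ = refl
        h′ (suc x) p = cong (rename suc) (h x p)

rename-id : ∀ {ρ} M → (∀ x → ρ x ≡ x) → rename ρ M ≡ M
rename-id (var x) h = cong var (h x)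
rename-id (M · N) h = cong₂ _·_ (rename-id M h) (rename-id N h)
rename-id {ρ} (ƛ M) h = cong ƛ_ (rename-id M h′)
  where h′ : ∀ x → ext ρ x ≡ x
        h′ zero    = refl
        h′ (suc x) = cong suc (h x)

subst-id : ∀ {σ} M → (∀ x → σ x ≡ var x) → subst σ M ≡ M
subst-id (var x) h = h x
subst-id (M · N) h = cong₂ _·_ (subst-id M h) (subst-id N h)
subst-id {σ} (ƛ M) h = cong ƛ_ (subst-id M h′)
  where h′ : ∀ x → exts σ x ≡ var x
        h′ zero    = refl
        h′ (suc x) = cong (rename suc) (h x)

rename-rename : ∀ {ρ ρ′ τ} M → (∀ x → ρ (ρ′ x) ≡ τ x) → rename ρ (rename ρ′ M) ≡ rename τ M
rename-rename (var x) h = cong var (h x)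
rename-rename (M · N) h = cong₂ _·_ (rename-rename M h) (rename-rename N h)
rename-rename {ρ} {ρ′} {τ} (ƛ M) h = cong ƛ_ (rename-rename M h′)
  where h′ : ∀ x → ext ρ (ext ρ′ x) ≡ ext τ x
        h′ zero    = refl
        h′ (suc x) = cong suc (h x)

subst-rename : ∀ {σ ρ τ} M → (∀ x → σ (ρ x) ≡ τ x) → subst σ (rename ρ M) ≡ subst τ M
subst-rename (var x) h = h x
subst-rename (M · N) h = cong₂ _·_ (subst-rename M h) (subst-rename N h)
subst-rename {σ} {ρ} {τ} (ƛ M) h = cong ƛ_ (subst-rename M h′)
  where h′ : ∀ x → exts σ (ext ρ x) ≡ exts τ x
        h′ zero    = refl
        h′ (suc x) = cong (rename suc) (h x)

rename-subst : ∀ {ρ σ τ} M → (∀ x → rename ρ (σ x) ≡ τ x) → rename ρ (subst σ M) ≡ subst τ M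
rename-subst (var x) h = h x
rename-subst (M · N) h = cong₂ _·_ (rename-subst M h) (rename-subst N h)
rename-subst {ρ} {σ} {τ} (ƛ M) h = cong ƛ_ (rename-subst M h′)
  where
  open ≡-Reasoning
  h′ : ∀ x → rename (ext ρ) (exts σ x) ≡ exts τ x
  h′ zero    = refl
  h′ (suc x) = begin
    rename (ext ρ) (rename suc (σ x)) ≡⟨ rename-rename (σ x) (λ _ → refl) ⟩
    rename (suc ∘ ρ) (σ x)            ≡⟨ rename-rename (σ x) (λ _ → refl) ⟨
    rename suc (rename ρ (σ x))       ≡⟨ cong (rename suc) (h x) ⟩
    rename suc (τ x)                  ∎

subst-subst : ∀ {σ τ υ} M → (∀ x → subst σ (τ x) ≡ υ x) → subst σ (subst τ M) ≡ subst υ M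
subst-subst (var x) h = h x
subst-subst (M · N) h = cong₂ _·_ (subst-subst M h) (subst-subst N h)
subst-subst {σ} {τ} {υ} (ƛ M) h = cong ƛ_ (subst-subst M h′)
  where
  open ≡-Reasoning
  h′ : ∀ x → subst (exts σ) (exts τ x) ≡ exts υ x
  h′ zero    = refl
  h′ (suc x) = begin
    subst (exts σ) (rename suc (τ x)) ≡⟨ subst-rename (τ x) (λ _ → refl) ⟩
    subst (rename suc ∘ σ) (τ x)      ≡⟨ rename-subst (τ x) (λ _ → refl) ⟨
    rename suc (subst σ (τ x))        ≡⟨ cong (rename suc) (h x) ⟩
    rename suc (υ x)                  ∎

rename-[] : ∀ ρ M N → rename ρ (M [ N ]) ≡ rename (ext ρ) M [ rename ρ N ]
rename-[] ρ M N = trans (rename-subst M (λ _ → refl)) (sym (subst-rename M σ₀-ext))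
  where σ₀-ext : ∀ x → σ₀ (rename ρ N) (ext ρ x) ≡ rename ρ (σ₀ N x)
        σ₀-ext zero    = refl
        σ₀-ext (suc x) = refl

subst-[] : ∀ σ M N → subst σ (M [ N ]) ≡ subst (exts σ) M [ subst σ N ]
subst-[] σ M N = trans (subst-subst M (λ _ → refl)) (sym (subst-subst M σ₀-exts))
  where σ₀-exts : ∀ x → subst (σ₀ (subst σ N)) (exts σ x) ≡ subst σ (σ₀ N x)
        σ₀-exts zero    = refl
        σ₀-exts (suc x) = trans (subst-rename (σ x) (λ _ → refl)) (subst-id (σ x) (λ _ → refl))

rename-apps : ∀ ρ M Ns → rename ρ (apps M Ns) ≡ apps (rename ρ M) (map (rename ρ) Ns)
rename-apps ρ M []       = refl
rename-apps ρ M (N ∷ Ns) = rename-apps ρ (M · N) Ns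

subst-apps : ∀ σ M Ns → subst σ (apps M Ns) ≡ apps (subst σ M) (map (subst σ) Ns)
subst-apps σ M []       = refl
subst-apps σ M (N ∷ Ns) = subst-apps σ (M · N) Ns

apps-++-[] : ∀ M Ns N → apps M (Ns ++ [ N ]ₗ) ≡ apps M Ns · N
apps-++-[] M []        N = refl
apps-++-[] M (N′ ∷ Ns) N = apps-++-[] (M · N′) Ns N

rename-apps-· : ∀ ρ M Ns N → rename ρ (apps M Ns) · N ≡ apps (rename ρ M) (map (rename ρ) Ns ++ [ N ]ₗ)
rename-apps-· ρ M Ns N = trans (cong (_· N) (rename-apps ρ M Ns)) (sym (apps-++-[] (rename ρ M) (map (rename ρ) Ns) N))

rename-apps-[] : ∀ ρ M N Ns →
                 rename ρ (apps (M [ N ]) Ns) ≡ apps (rename (ext ρ) M [ rename ρ N ]) (map (rename ρ) Ns)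
rename-apps-[] ρ M N Ns =
  trans (rename-apps ρ (M [ N ]) Ns) (cong (λ t → apps t (map (rename ρ) Ns)) (rename-[] ρ M N))

subst-apps-[] : ∀ σ M N Ns →
                subst σ (apps (M [ N ]) Ns) ≡ apps (subst (exts σ) M [ subst σ N ]) (map (subst σ) Ns)
subst-apps-[] σ M N Ns =
  trans (subst-apps σ (M [ N ]) Ns) (cong (λ t → apps t (map (subst σ) Ns)) (subst-[] σ M N))

update : {A : Set} → (ℕ → A) → ℕ → A → ℕ → A
update f y a z with z ≟ y
... | yes _ = a
... | no  _ = f z

update-≡ : ∀ {A : Set} (f : ℕ → A) y a → update f y a y ≡ a
update-≡ f y a with y ≟ y
... | yes _   = refl
... | no  y≢y = contradiction refl y≢y

update-≢ : ∀ {A : Set} (f : ℕ → A) {y} a {z} → z ≢ y → update f y a z ≡ f z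
update-≢ f {y} a {z} z≢y with z ≟ y
... | yes z≡y = contradiction z≡y z≢y
... | no  _   = refl

map-rename-update : ∀ ρ {y} y′ Ns → y ∉FVs Ns → map (rename (update ρ y y′)) Ns ≡ map (rename ρ) Ns
map-rename-update ρ y′ []       _              = refl
map-rename-update ρ y′ (N ∷ Ns) (y∉N , y∉Ns) =
  cong₂ _∷_ (rename-cong N (λ x x∈N → update-≢ ρ y′ λ { refl → y∉N x∈N }))
            (map-rename-update ρ y′ Ns y∉Ns)

map-subst-update : ∀ σ {y} P Ns → y ∉FVs Ns → map (subst (update σ y P)) Ns ≡ map (subst σ) Ns
map-subst-update σ P []       _              = refl
map-subst-update σ P (N ∷ Ns) (y∉N , y∉Ns) =
  cong₂ _∷_ (subst-cong N (λ x x∈N → update-≢ σ P λ { refl → y∉N x∈N }))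
            (map-subst-update σ P Ns y∉Ns)

rename-update-apps : ∀ ρ {y} y′ Ns → y ∉FVs Ns →
                     rename (update ρ y y′) (apps (var y) Ns) ≡ apps (var y′) (map (rename ρ) Ns)
rename-update-apps ρ {y} y′ Ns y∉Ns =
  trans (rename-apps _ (var y) Ns) (cong₂ apps (cong var (update-≡ ρ y y′)) (map-rename-update ρ y′ Ns y∉Ns))

subst-update-apps : ∀ σ {y} P Ns → y ∉FVs Ns →
                    subst (update σ y P) (apps (var y) Ns) ≡ apps P (map (subst σ) Ns)
subst-update-apps σ {y} P Ns y∉Ns =
  trans (subst-apps _ (var y) Ns) (cong₂ apps (update-≡ σ y P) (map-subst-update σ P Ns y∉Ns))

⊢-resp-≡ : ∀ {Γ M M′ C} → M ≡ M′ → Γ ⊢ˢ M ∶ C → Γ ⊢ˢ M′ ∶ C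
⊢-resp-≡ refl d = d

Ax-∈ : ∀ {Γ x A} → (x , A) ∈ Γ → Γ ⊢ˢ var x ∶ A
Ax-∈ m = Ax (∈⇒≋∷ m)

L∩-∈ : ∀ {Γ x Ns A₁ A₂ B} → (x , A₁ ∩ A₂) ∈ Γ →
       ((x , A₁) ∷ (x , A₂) ∷ Γ) ⊢ˢ apps (var x) Ns ∶ B → Γ ⊢ˢ apps (var x) Ns ∶ B
L∩-∈ {Ns = Ns} m d = L∩ {Ns = Ns} (∈⇒≋∷ m) d

L⇒-fresh : ∀ {Γ x N Ns A₁ A₂ B} → (x , A₁ ⇒ A₂) ∈ Γ → Γ ⊢ˢ N ∶ A₁ →
           ((fresh Γ Ns , A₂) ∷ Γ) ⊢ˢ apps (var (fresh Γ Ns)) Ns ∶ B → Γ ⊢ˢ apps (var x · N) Ns ∶ B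
L⇒-fresh {Γ} {Ns = Ns} m dN d = L⇒ (∈⇒≋∷ m) (fresh-∉FVs Γ Ns) (fresh-∉Ctx Γ Ns) dN d

_⊆[_]_ : Ctx → (ℕ → ℕ) → Ctx → Set
Γ ⊆[ ρ ] Δ = ∀ {x T} → (x , T) ∈ Γ → (ρ x , T) ∈ Δ

⊆-⊆[] : ∀ {Γ Γ′ Δ ρ} → Γ ⊆ Γ′ → Γ′ ⊆[ ρ ] Δ → Γ ⊆[ ρ ] Δ
⊆-⊆[] Γ⊆Γ′ h m = h (Γ⊆Γ′ m)

⊆[]-∷ : ∀ {Γ Δ ρ x A} → Γ ⊆[ ρ ] Δ → ((x , A) ∷ Γ) ⊆[ ρ ] ((ρ x , A) ∷ Δ)
⊆[]-∷ h (here refl) = here refl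
⊆[]-∷ h (there m)   = there (h m)

⊆[]-ext : ∀ {Γ Δ ρ A} → Γ ⊆[ ρ ] Δ → ((zero , A) ∷ shiftCtx Γ) ⊆[ ext ρ ] ((zero , A) ∷ shiftCtx Δ)
⊆[]-ext h (here refl) = here refl
⊆[]-ext h (there m) with ∈-shiftCtx⁻ m
... | _ , refl , m′ = there (∈-shiftCtx⁺ (h m′))

⊆[]-update : ∀ {Γ Δ ρ y y′ A} → Γ ⊆[ ρ ] Δ → y ∉Ctx Γ →
             ((y , A) ∷ Γ) ⊆[ update ρ y y′ ] ((y′ , A) ∷ Δ)
⊆[]-update {ρ = ρ} {y} {y′} {A} h y∉Γ (here refl) = here (cong (_, A) (update-≡ ρ y y′))
⊆[]-update {Δ = Δ} {ρ} {y} {y′} h y∉Γ {T = T} (there m) =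
  there (≡-subst (λ w → (w , T) ∈ Δ) (sym (update-≢ ρ y′ (∉Ctx⇒≢ y∉Γ m))) (h m))

rename-⊢ : ∀ {Γ Δ M C} ρ → Γ ⊆[ ρ ] Δ → Γ ⊢ˢ M ∶ C → Δ ⊢ˢ rename ρ M ∶ C
rename-⊢ ρ h (Ax e) = Ax-∈ (h (≋∷⇒∈ e))
rename-⊢ ρ h (Beta {M = M} {N} {Ns} d₁ d₂) =
  ⊢-resp-≡ (sym (rename-apps ρ ((ƛ M) · N) Ns))
    (Beta {M = rename (ext ρ) M} {Ns = map (rename ρ) Ns}
      (⊢-resp-≡ (rename-apps-[] ρ M N Ns) (rename-⊢ ρ h d₁)) (rename-⊢ ρ h d₂))
rename-⊢ {Δ = Δ} ρ h (L⇒ {x = x} {y} {N} {Ns} e y∉Ns y∉Γ d₁ d₂) =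
  ⊢-resp-≡ (sym (rename-apps ρ (var x · N) Ns))
    (L⇒-fresh {Ns = Ns′} (h (≋∷⇒∈ e)) (rename-⊢ ρ h⁻ d₁)
      (⊢-resp-≡ (rename-update-apps ρ y′ Ns y∉Ns) (rename-⊢ (update ρ y y′) (⊆[]-update h⁻ y∉Γ) d₂)))
  where Ns′ = map (rename ρ) Ns
        y′ = fresh Δ Ns′
        h⁻ = ⊆-⊆[] (≋∷⇒⊆ e) h
rename-⊢ ρ h (R⇒ d) = R⇒ (rename-⊢ (ext ρ) (⊆[]-ext h) d)
rename-⊢ ρ h (L∩ {x = x} {Ns} e d) =
  ⊢-resp-≡ (sym eq) (L∩-∈ {Ns = map (rename ρ) Ns} (h (≋∷⇒∈ e))
    (⊢-resp-≡ eq (rename-⊢ ρ (⊆[]-∷ (⊆[]-∷ (⊆-⊆[] (≋∷⇒⊆ e) h))) d)))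
  where eq = rename-apps ρ (var x) Ns
rename-⊢ ρ h (R∩ d₁ d₂) = R∩ (rename-⊢ ρ h d₁) (rename-⊢ ρ h d₂)

weaken : ∀ {Γ Δ M C} → Γ ⊆ Δ → Γ ⊢ˢ M ∶ C → Δ ⊢ˢ M ∶ C
weaken {M = M} Γ⊆Δ d = ⊢-resp-≡ (rename-id M (λ _ → refl)) (rename-⊢ id Γ⊆Δ d)

∩-elimˡ : ∀ {Γ M A B} → Γ ⊢ˢ M ∶ A ∩ B → Γ ⊢ˢ M ∶ A
∩-elimˡ (Ax e)                         = L∩-∈ {Ns = []} (≋∷⇒∈ e) (Ax-∈ (here refl))
∩-elimˡ (Beta {M = M} {Ns = Ns} d₁ d₂) = Beta {M = M} {Ns = Ns} (∩-elimˡ d₁) d₂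
∩-elimˡ (L⇒ {x = x} {N = N} {Ns} e y∉Ns y∉Γ d₁ d₂) =
  L⇒ {x = x} {N = N} {Ns} e y∉Ns y∉Γ d₁ (∩-elimˡ d₂)
∩-elimˡ (L∩ {x = x} {Ns} e d)          = L∩ {x = x} {Ns} e (∩-elimˡ d)
∩-elimˡ (R∩ d₁ d₂)                     = d₁

∩-elimʳ : ∀ {Γ M A B} → Γ ⊢ˢ M ∶ A ∩ B → Γ ⊢ˢ M ∶ B
∩-elimʳ (Ax e)                         = L∩-∈ {Ns = []} (≋∷⇒∈ e) (Ax-∈ (there (here refl)))
∩-elimʳ (Beta {M = M} {Ns = Ns} d₁ d₂) = Beta {M = M} {Ns = Ns} (∩-elimʳ d₁) d₂
∩-elimʳ (L⇒ {x = x} {N = N} {Ns} e y∉Ns y∉Γ d₁ d₂) =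
  L⇒ {x = x} {N = N} {Ns} e y∉Ns y∉Γ d₁ (∩-elimʳ d₂)
∩-elimʳ (L∩ {x = x} {Ns} e d)          = L∩ {x = x} {Ns} e (∩-elimʳ d)
∩-elimʳ (R∩ d₁ d₂)                     = d₂

size : Ty → ℕ
size (atom _) = 1
size (A ⇒ B)  = suc (size A + size B)
size (A ∩ B)  = suc (size A + size B)

size-∩ˡ : ∀ A B → size A ≤ size (A ∩ B)
size-∩ˡ A B = m≤n⇒m≤1+n (m≤m+n (size A) (size B))

size-∩ʳ : ∀ A B → size B ≤ size (A ∩ B)
size-∩ʳ A B = m≤n⇒m≤1+n (m≤n+m (size B) (size A))

-- A variable may be replaced by a variable at any type, but by another
-- term only at a type of size ≤ k, the size of the cuts this creates.
data Substitutable (k : ℕ) (Δ : Ctx) (t : Term) (T : Ty) : Set where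
  var∈  : ∀ {w} → t ≡ var w → (w , T) ∈ Δ → Substitutable k Δ t T
  typed : size T ≤ k → Δ ⊢ˢ t ∶ T → Substitutable k Δ t T

Substitutable⇒⊢ : ∀ {k Δ t T} → Substitutable k Δ t T → Δ ⊢ˢ t ∶ T
Substitutable⇒⊢ (var∈ refl m) = Ax-∈ m
Substitutable⇒⊢ (typed _ d)   = d

Substitutable-resp : ∀ {k Δ Δ′ t t′ T} → t ≡ t′ → Δ ⊆ Δ′ →
                     Substitutable k Δ t T → Substitutable k Δ′ t′ T
Substitutable-resp refl Δ⊆Δ′ (var∈ eq m) = var∈ eq (Δ⊆Δ′ m)
Substitutable-resp refl Δ⊆Δ′ (typed le d) = typed le (weaken Δ⊆Δ′ d)

_⇛[_,_]_ : Ctx → ℕ → (ℕ → Term) → Ctx → Set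
Γ ⇛[ k , σ ] Δ = ∀ {z T} → (z , T) ∈ Γ → Substitutable k Δ (σ z) T

⊆-⇛ : ∀ {Γ Γ′ Δ k σ} → Γ ⊆ Γ′ → Γ′ ⇛[ k , σ ] Δ → Γ ⇛[ k , σ ] Δ
⊆-⇛ Γ⊆Γ′ h m = h (Γ⊆Γ′ m)

⇛-weaken : ∀ {Γ Δ Δ′ k σ} → Γ ⇛[ k , σ ] Δ → Δ ⊆ Δ′ → Γ ⇛[ k , σ ] Δ′
⇛-weaken h Δ⊆Δ′ m = Substitutable-resp refl Δ⊆Δ′ (h m)

⇛-∷ : ∀ {Γ Δ k σ x A} → Γ ⇛[ k , σ ] Δ → Substitutable k Δ (σ x) A → ((x , A) ∷ Γ) ⇛[ k , σ ] Δ
⇛-∷ h s (here refl) = s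
⇛-∷ h s (there m)   = h m

⇛-update : ∀ {Γ Δ k σ y P A} → Γ ⇛[ k , σ ] Δ → y ∉Ctx Γ → Substitutable k Δ P A →
           ((y , A) ∷ Γ) ⇛[ k , update σ y P ] Δ
⇛-update {σ = σ} {y} {P} h y∉Γ s (here refl) = Substitutable-resp (sym (update-≡ σ y P)) id s
⇛-update {σ = σ} {y} {P} h y∉Γ s (there m) =
  Substitutable-resp (sym (update-≢ σ P (∉Ctx⇒≢ y∉Γ m))) id (h m)

⇛-∷∷-var : ∀ {Γ Δ k σ x w A₁ A₂} → Γ ⇛[ k , σ ] Δ → σ x ≡ var w →
            ((x , A₁) ∷ (x , A₂) ∷ Γ) ⇛[ k , σ ] ((w , A₁) ∷ (w , A₂) ∷ Δ)
⇛-∷∷-var h σx≡w =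
  ⇛-∷ (⇛-∷ (⇛-weaken h (there ∘ there)) (var∈ σx≡w (there (here refl)))) (var∈ σx≡w (here refl))

⇛-∷∷-∩ : ∀ {Γ Δ k σ x A₁ A₂} → Γ ⇛[ k , σ ] Δ → size (A₁ ∩ A₂) ≤ k → Δ ⊢ˢ σ x ∶ A₁ ∩ A₂ →
         ((x , A₁) ∷ (x , A₂) ∷ Γ) ⇛[ k , σ ] Δ
⇛-∷∷-∩ {A₁ = A₁} {A₂} h le dx =
  ⇛-∷ (⇛-∷ h (typed (≤-trans (size-∩ʳ A₁ A₂) le) (∩-elimʳ dx)))
      (typed (≤-trans (size-∩ˡ A₁ A₂) le) (∩-elimˡ dx))

⇛-exts : ∀ {Γ Δ k σ A} → Γ ⇛[ k , σ ] Δ →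
         ((zero , A) ∷ shiftCtx Γ) ⇛[ k , exts σ ] ((zero , A) ∷ shiftCtx Δ)
⇛-exts h (here refl) = var∈ refl (here refl)
⇛-exts h (there m) with ∈-shiftCtx⁻ m
... | _ , refl , m′ with h m′
...   | var∈ eq mw = var∈ (cong (rename suc) eq) (there (∈-shiftCtx⁺ mw))
...   | typed le d = typed le (rename-⊢ suc (there ∘ ∈-shiftCtx⁺) d)

⇛-β : ∀ {Γ Δ k ρ N A} → Γ ⊆[ ρ ] Δ → size A ≤ k → Δ ⊢ˢ N ∶ A →
      ((zero , A) ∷ shiftCtx Γ) ⇛[ k , σ₀ N ∘ ext ρ ] Δ
⇛-β h le dN (here refl) = typed le dN
⇛-β h le dN (there m) with ∈-shiftCtx⁻ m
... | _ , refl , m′ = var∈ refl (h m′)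

SubstAdmissible : ℕ → Set
SubstAdmissible k = ∀ {Γ Δ M C} σ → Γ ⇛[ k , σ ] Δ → Γ ⊢ˢ M ∶ C → Δ ⊢ˢ subst σ M ∶ C

AppAdmissible : ℕ → Set
AppAdmissible k = ∀ {Γ Δ P N A B} ρ → size A ≤ k → Γ ⊆[ ρ ] Δ →
                  Γ ⊢ˢ P ∶ A ⇒ B → Δ ⊢ˢ N ∶ A → Δ ⊢ˢ rename ρ P · N ∶ B

AppAdmissibleBelow : ℕ → Set
AppAdmissibleBelow zero    = ⊤
AppAdmissibleBelow (suc k) = AppAdmissible k

AppAdmissible⇒app : ∀ {k Δ P N A B} → AppAdmissible k → size A ≤ k →
                    Δ ⊢ˢ P ∶ A ⇒ B → Δ ⊢ˢ N ∶ A → Δ ⊢ˢ P · N ∶ B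
AppAdmissible⇒app {P = P} app le dP dN =
  ⊢-resp-≡ (cong (_· _) (rename-id P (λ _ → refl))) (app id le id dP dN)

subst-⊢ : ∀ k → AppAdmissibleBelow k → SubstAdmissible k
subst-⊢ k app σ h (Ax e) = Substitutable⇒⊢ (h (≋∷⇒∈ e))
subst-⊢ k app σ h (Beta {M = M} {N} {Ns} d₁ d₂) =
  ⊢-resp-≡ (sym (subst-apps σ ((ƛ M) · N) Ns))
    (Beta {M = subst (exts σ) M} {Ns = map (subst σ) Ns}
      (⊢-resp-≡ (subst-apps-[] σ M N Ns) (subst-⊢ k app σ h d₁)) (subst-⊢ k app σ h d₂))
subst-⊢ k app σ h (R⇒ d) = R⇒ (subst-⊢ k app (exts σ) (⇛-exts h) d)
subst-⊢ k app σ h (R∩ d₁ d₂) = R∩ (subst-⊢ k app σ h d₁) (subst-⊢ k app σ h d₂)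
subst-⊢ k app σ h (L∩ {x = x} {Ns} e d) with h (≋∷⇒∈ e)
... | var∈ σx≡w m =
  ⊢-resp-≡ (sym eq) (L∩-∈ {Ns = map (subst σ) Ns} m
    (⊢-resp-≡ eq (subst-⊢ k app σ (⇛-∷∷-var h⁻ σx≡w) d)))
  where h⁻ = ⊆-⇛ (≋∷⇒⊆ e) h
        eq = trans (subst-apps σ (var x) Ns) (cong (λ t → apps t (map (subst σ) Ns)) σx≡w)
... | typed le dx = subst-⊢ k app σ (⇛-∷∷-∩ (⊆-⇛ (≋∷⇒⊆ e) h) le dx) d
subst-⊢ k app {Δ = Δ} σ h (L⇒ {x = x} {y} {N} {Ns} e y∉Ns y∉Γ d₁ d₂) with h (≋∷⇒∈ e)
... | var∈ σx≡w m =
  ⊢-resp-≡ (sym eq) (L⇒-fresh {Ns = Ns′} m (subst-⊢ k app σ h⁻ d₁)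
    (⊢-resp-≡ (subst-update-apps σ (var y′) Ns y∉Ns)
      (subst-⊢ k app (update σ y (var y′)) (⇛-update (⇛-weaken h⁻ there) y∉Γ (var∈ refl (here refl)))
        d₂)))
  where Ns′ = map (subst σ) Ns
        y′ = fresh Δ Ns′
        h⁻ = ⊆-⇛ (≋∷⇒⊆ e) h
        eq = trans (subst-apps σ (var x · N) Ns) (cong (λ t → apps (t · subst σ N) Ns′) σx≡w)
-- Here the (L→) step is a cut with the substituted head, and y stands for σ x · N.
subst-⊢ (suc k) app σ h (L⇒ {x = x} {y} {N} {Ns} {A₁} {A₂} e y∉Ns y∉Γ d₁ d₂) | typed (s≤s le) dx =
  ⊢-resp-≡ (sym (subst-apps σ (var x · N) Ns))
    (⊢-resp-≡ (subst-update-apps σ Q Ns y∉Ns)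
      (subst-⊢ (suc k) app (update σ y Q) (⇛-update h⁻ y∉Γ (typed A₂≤ dQ)) d₂))
  where Q = σ x · subst σ N
        h⁻ = ⊆-⇛ (≋∷⇒⊆ e) h
        A₂≤ = m≤n⇒m≤1+n (≤-trans (m≤n+m (size A₂) (size A₁)) le)
        dQ = AppAdmissible⇒app app (≤-trans (m≤m+n (size A₁) (size A₂)) le) dx
               (subst-⊢ (suc k) app σ h⁻ d₁)

app-⊢ : ∀ k → SubstAdmissible k → AppAdmissible k
app-⊢ k sub ρ le h (Ax e) dN = L⇒-fresh {Ns = []} (h (≋∷⇒∈ e)) dN (Ax-∈ (here refl))
app-⊢ k sub ρ le h (Beta {M = M} {N′} {Ns} d₁ d₂) dN =
  ⊢-resp-≡ (sym (rename-apps-· ρ ((ƛ M) · N′) Ns _))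
    (Beta {M = rename (ext ρ) M} {Ns = map (rename ρ) Ns ++ [ _ ]ₗ}
      (⊢-resp-≡ eq (app-⊢ k sub ρ le h d₁ dN)) (rename-⊢ ρ h d₂))
  where eq = trans (rename-apps-· ρ (M [ N′ ]) Ns _)
                   (cong (λ t → apps t (map (rename ρ) Ns ++ [ _ ]ₗ)) (rename-[] ρ M N′))
app-⊢ k sub {Δ = Δ} {N = N} ρ le h (L⇒ {x = x} {y} {N′} {Ns} e y∉Ns y∉Γ d₁ d₂) dN =
  ⊢-resp-≡ (sym (rename-apps-· ρ (var x · N′) Ns N))
    (L⇒-fresh {Ns = Ns′} (h (≋∷⇒∈ e)) (rename-⊢ ρ h⁻ d₁)
      (⊢-resp-≡ eq (app-⊢ k sub (update ρ y y′) le (⊆[]-update h⁻ y∉Γ) d₂ (weaken there dN))))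
  where Ns′ = map (rename ρ) Ns ++ [ N ]ₗ
        y′ = fresh Δ Ns′
        h⁻ = ⊆-⊆[] (≋∷⇒⊆ e) h
        eq = trans (cong (_· N) (rename-update-apps ρ y′ Ns y∉Ns))
                   (sym (apps-++-[] (var y′) (map (rename ρ) Ns) N))
app-⊢ k sub {N = N} ρ le h (L∩ {x = x} {Ns} e d) dN =
  ⊢-resp-≡ (sym eq) (L∩-∈ {Ns = map (rename ρ) Ns ++ [ N ]ₗ} (h (≋∷⇒∈ e))
    (⊢-resp-≡ eq (app-⊢ k sub ρ le (⊆[]-∷ (⊆[]-∷ (⊆-⊆[] (≋∷⇒⊆ e) h))) d
      (weaken (there ∘ there) dN))))
  where eq = rename-apps-· ρ (var x) Ns N
app-⊢ k sub {N = N} ρ le h (R⇒ {M = M} d) dN =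
  Beta {M = rename (ext ρ) M} {Ns = []}
    (⊢-resp-≡ (sym (subst-rename M (λ _ → refl))) (sub _ (⇛-β h le dN) d)) dN

subst-admissible : ∀ k → SubstAdmissible k
subst-admissible zero    = subst-⊢ zero tt
subst-admissible (suc k) = subst-⊢ (suc k) (app-⊢ k (subst-admissible k))

lemma5 : ∀ {Γ M N A B} → Γ ⊢ˢ M ∶ A ⇒ B → Γ ⊢ˢ N ∶ A → Γ ⊢ˢ M · N ∶ B
lemma5 {A = A} = AppAdmissible⇒app (app-⊢ (size A) (subst-admissible (size A))) ≤-refl
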